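{- For any valid packing $p$ of a set of items into a sequence of bins, there is a thrifty packing of those items into that sequence using a subset of the bins used by $p$.
   Context: Items have positive integer sizes; bins arrive in a sequence and have positive integer sizes. A packing assigns every item to a bin so that the total size of items in each bin is at most its size. A packing is valid if each empty bin is smaller than every item packed in a later bin. A bin in a packing is wasteful if its empty space (size minus total size of items in it) is at least as large as some item packed in a bin occurring later in the sequence. A packing is thrifty if it has no wasteful bins. A bin is used if at least one item is assigned to it. -}

module Defs where

open import Data.Nat using (ℕ; zero; suc; _+_; _∸_; _≤_; _<_)
open import Data.Fin using (Fin; zero; suc; _≟_)
open import Data.Product using (Σ; ∃; _×_)
open import Relation.Nullary using (¬_; yes; no)
open import Relation.Binary.PropositionalEquality using (_≡_; _≢_)

load : {m n : ℕ} → (Fin m → ℕ) → (Fin m → Fin n) → Fin n → ℕ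
load {zero}  s a j = 0
load {suc m} s a j with a zero ≟ j
... | yes _ = s zero + load {m} (λ i → s (suc i)) (λ i → a (suc i)) j
... | no  _ = load {m} (λ i → s (suc i)) (λ i → a (suc i)) j

record Packing {m n : ℕ} (s : Fin m → ℕ) (b : Fin n → ℕ) : Set where
  constructor packing
  field
    assign : Fin m → Fin n
    fits   : ∀ j → load s assign j ≤ b j
open Packing public

Used : {m n : ℕ} {s : Fin m → ℕ} {b : Fin n → ℕ} → Packing s b → Fin n → Set
Used p j = ∃ λ i → assign p i ≡ j

Empty : {m n : ℕ} {s : Fin m → ℕ} {b : Fin n → ℕ} → Packing s b → Fin n → Set
Empty p j = ∀ i → assign p i ≢ j

Valid : {m n : ℕ} {s : Fin m → ℕ} {b : Fin n → ℕ} → Packing s b → Set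
Valid {s = s} {b = b} p =
  ∀ j → Empty p j → ∀ i → j Data.Fin.< assign p i → b j < s i

Wasteful : {m n : ℕ} {s : Fin m → ℕ} {b : Fin n → ℕ} → Packing s b → Fin n → Set
Wasteful {s = s} {b = b} p j =
  ∃ λ i → (j Data.Fin.< assign p i) × (s i ≤ b j ∸ load s (assign p) j)

Thrifty : {m n : ℕ} {s : Fin m → ℕ} {b : Fin n → ℕ} → Packing s b → Set
Thrifty p = ∀ j → ¬ Wasteful p j

-- Repeatedly move a later item into a wasteful bin that has room for it.
-- Each move sends an item to an earlier bin, so the sum of the bin indices
-- of the items strictly decreases and the process ends in a thrifty packing.
-- Since items only ever move to earlier bins, a bin that receives an item
-- was already used by p: had it been empty in p, validity would make it
-- smaller than the item it now has room for.
module Submission where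

open import Defs
open import Data.Nat using (ℕ; zero; suc; _+_; _∸_; _≤_; _<_)
open import Data.Nat.Properties hiding (_≟_; _<?_)
open import Data.Nat.Induction using (<-wellFounded)
open import Data.Fin as Fin using (Fin; toℕ; _≟_; _<?_)
open import Data.Fin.Properties using (any?)
open import Data.Vec.Functional using (updateAt)
open import Data.Vec.Functional.Properties using (updateAt-updates; updateAt-minimal)
open import Data.Product using (Σ; ∃; _×_; _,_)
open import Data.Sum using (_⊎_; inj₁; inj₂)
open import Data.Empty using (⊥-elim)
open import Function using (const)
open import Induction.WellFounded using (Acc; acc)
open import Relation.Nullary using (Dec; yes; no)
open import Relation.Nullary.Decidable using (_×-dec_)
open import Relation.Binary.PropositionalEquality

pointMass : ∀ {n} → Fin n → ℕ → Fin n → ℕ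
pointMass x v k with x ≟ k
... | yes _ = v
... | no  _ = 0

pointMass-here : ∀ {n} (x : Fin n) v → pointMass x v x ≡ v
pointMass-here x v with x ≟ x
... | yes _  = refl
... | no x≢x = ⊥-elim (x≢x refl)

pointMass-elsewhere : ∀ {n} {x k : Fin n} v → x ≢ k → pointMass x v k ≡ 0
pointMass-elsewhere {x = x} {k} v x≢k with x ≟ k
... | yes x≡k = ⊥-elim (x≢k x≡k)
... | no  _   = refl

moveItem : ∀ {m n} → (Fin m → Fin n) → Fin m → Fin n → Fin m → Fin n
moveItem a i j = updateAt a i (const j)

load-moveItem : ∀ {m n} (s : Fin m → ℕ) (a : Fin m → Fin n) i j k →
  load s (moveItem a i j) k + pointMass (a i) (s i) k ≡ load s a k + pointMass j (s i) k
load-moveItem {suc m} s a Fin.zero j k with j ≟ k | a Fin.zero ≟ k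
... | yes _ | yes _ = refl
... | yes _ | no  _ = trans (+-identityʳ _) (+-comm (s Fin.zero) _)
... | no  _ | yes _ = trans (+-comm _ (s Fin.zero)) (sym (+-identityʳ _))
... | no  _ | no  _ = refl
load-moveItem {suc m} s a (Fin.suc i) j k with a Fin.zero ≟ k
... | yes _ = begin
  s Fin.zero + load s′ (moveItem a′ i j) k + pointMass (a′ i) (s′ i) k
    ≡⟨ +-assoc (s Fin.zero) _ _ ⟩
  s Fin.zero + (load s′ (moveItem a′ i j) k + pointMass (a′ i) (s′ i) k)
    ≡⟨ cong (s Fin.zero +_) (load-moveItem s′ a′ i j k) ⟩
  s Fin.zero + (load s′ a′ k + pointMass j (s′ i) k)
    ≡⟨ +-assoc (s Fin.zero) _ _ ⟨
  s Fin.zero + load s′ a′ k + pointMass j (s′ i) k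
    ∎
  where
  open ≡-Reasoning
  s′ = λ x → s (Fin.suc x)
  a′ = λ x → a (Fin.suc x)
... | no  _ = load-moveItem (λ x → s (Fin.suc x)) (λ x → a (Fin.suc x)) i j k

load-moveItem-target : ∀ {m n} (s : Fin m → ℕ) (a : Fin m → Fin n) i j →
  load s (moveItem a i j) j ≤ load s a j + s i
load-moveItem-target s a i j = begin
  load s (moveItem a i j) j                               ≤⟨ m≤m+n _ _ ⟩
  load s (moveItem a i j) j + pointMass (a i) (s i) j     ≡⟨ load-moveItem s a i j j ⟩
  load s a j + pointMass j (s i) j                        ≡⟨ cong (load s a j +_) (pointMass-here j (s i)) ⟩
  load s a j + s i                                        ∎
  where open ≤-Reasoning

load-moveItem-other : ∀ {m n} (s : Fin m → ℕ) (a : Fin m → Fin n) i {j k} → j ≢ k →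
  load s (moveItem a i j) k ≤ load s a k
load-moveItem-other s a i {j} {k} j≢k = begin
  load s (moveItem a i j) k                               ≤⟨ m≤m+n _ _ ⟩
  load s (moveItem a i j) k + pointMass (a i) (s i) k     ≡⟨ load-moveItem s a i j k ⟩
  load s a k + pointMass j (s i) k                        ≡⟨ cong (load s a k +_) (pointMass-elsewhere (s i) j≢k) ⟩
  load s a k + 0                                          ≡⟨ +-identityʳ _ ⟩
  load s a k                                              ∎
  where open ≤-Reasoning

binIndexSum : ∀ {m n} → (Fin m → Fin n) → ℕ
binIndexSum {zero}  a = 0
binIndexSum {suc m} a = toℕ (a Fin.zero) + binIndexSum (λ x → a (Fin.suc x))

binIndexSum-moveItem : ∀ {m n} (a : Fin m → Fin n) i j →
  binIndexSum (moveItem a i j) + toℕ (a i) ≡ binIndexSum a + toℕ j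
binIndexSum-moveItem {suc m} a Fin.zero j =
  trans (+-assoc (toℕ j) _ _) (trans (cong (toℕ j +_) (+-comm _ (toℕ (a Fin.zero))))
        (+-comm (toℕ j) _))
binIndexSum-moveItem {suc m} a (Fin.suc i) j =
  trans (+-assoc (toℕ (a Fin.zero)) _ _)
        (trans (cong (toℕ (a Fin.zero) +_) (binIndexSum-moveItem (λ x → a (Fin.suc x)) i j))
               (sym (+-assoc (toℕ (a Fin.zero)) _ _)))

binIndexSum-moveItem-< : ∀ {m n} (a : Fin m → Fin n) i j → j Fin.< a i →
  binIndexSum (moveItem a i j) < binIndexSum a
binIndexSum-moveItem-< a i j j<ai = +-cancelʳ-< (toℕ (a i)) _ _ (begin-strict
  binIndexSum (moveItem a i j) + toℕ (a i) ≡⟨ binIndexSum-moveItem a i j ⟩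
  binIndexSum a + toℕ j                    <⟨ +-monoʳ-< (binIndexSum a) j<ai ⟩
  binIndexSum a + toℕ (a i)                ∎)
  where open ≤-Reasoning

module _ {m n : ℕ} {s : Fin m → ℕ} {b : Fin n → ℕ} where

  wasteful? : (q : Packing s b) → ∀ j → Dec (Wasteful q j)
  wasteful? q j = any? λ i → (j <? assign q i) ×-dec (s i ≤? b j ∸ load s (assign q) j)

  thrifty-or-wasteful : (q : Packing s b) → Thrifty q ⊎ ∃ (Wasteful q)
  thrifty-or-wasteful q with any? (wasteful? q)
  ... | yes w = inj₂ w
  ... | no ¬w = inj₁ λ j w → ¬w (j , w)

  fillWasteful : (q : Packing s b) {j : Fin n} → Wasteful q j → Packing s b
  fillWasteful q {j} (i , _ , room) = packing (moveItem (assign q) i j) fits′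
    where
    fits′ : ∀ k → load s (moveItem (assign q) i j) k ≤ b k
    fits′ k with j ≟ k
    ... | yes refl = begin
      load s (moveItem (assign q) i j) j       ≤⟨ load-moveItem-target s (assign q) i j ⟩
      load s (assign q) j + s i                ≤⟨ +-monoʳ-≤ _ room ⟩
      load s (assign q) j + (b j ∸ load s (assign q) j) ≡⟨ m+[n∸m]≡n (fits q j) ⟩
      b j                                      ∎
      where open ≤-Reasoning
    ... | no j≢k = ≤-trans (load-moveItem-other s (assign q) i j≢k) (fits q k)

  fillWasteful-decreases : (q : Packing s b) {j : Fin n} (w : Wasteful q j) →
    binIndexSum (assign (fillWasteful q w)) < binIndexSum (assign q)
  fillWasteful-decreases q {j} (i , j<qi , _) = binIndexSum-moveItem-< (assign q) i j j<qi

  record ShiftedFrom (p q : Packing s b) : Set where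
    field
      earlier  : ∀ i → assign q i Fin.≤ assign p i
      usedOnly : ∀ j → Used q j → Used p j
  open ShiftedFrom

  shiftedFrom-refl : (p : Packing s b) → ShiftedFrom p p
  shiftedFrom-refl p = record { earlier = λ _ → ≤-refl ; usedOnly = λ _ u → u }

  wasteful⇒used : {p q : Packing s b} → Valid p → ShiftedFrom p q →
    ∀ {j} → Wasteful q j → Used p j
  wasteful⇒used {p} {q} vp sh {j} (i , j<qi , room) with any? (λ x → assign p x ≟ j)
  ... | yes used = used
  ... | no unused = ⊥-elim (<⇒≱ bj<si (≤-trans room (m∸n≤m (b j) (load s (assign q) j))))
    where
    bj<si = vp j (λ x e → unused (x , e)) i (<-≤-trans j<qi (earlier sh i))

  fillWasteful-shifted : {p q : Packing s b} → Valid p → ShiftedFrom p q →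
    ∀ {j} (w : Wasteful q j) → ShiftedFrom p (fillWasteful q w)
  fillWasteful-shifted {p} {q} vp sh {j} w@(i , j<qi , _) = record
    { earlier = earlier′ ; usedOnly = usedOnly′ }
    where
    earlier′ : ∀ x → moveItem (assign q) i j x Fin.≤ assign p x
    earlier′ x with x ≟ i
    ... | yes refl rewrite updateAt-updates i {const j} (assign q) =
      ≤-trans (<⇒≤ j<qi) (earlier sh i)
    ... | no x≢i rewrite updateAt-minimal x i {const j} (assign q) x≢i = earlier sh x
    usedOnly′ : ∀ k → Used (fillWasteful q w) k → Used p k
    usedOnly′ k (x , e) with x ≟ i
    ... | yes refl = subst (Used p) (trans (sym (updateAt-updates i (assign q))) e)
                       (wasteful⇒used vp sh w)
    ... | no x≢i = usedOnly sh k (x , trans (sym (updateAt-minimal x i (assign q) x≢i)) e)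

  thriftyShift : {p : Packing s b} → Valid p → (q : Packing s b) → ShiftedFrom p q →
    Acc _<_ (binIndexSum (assign q)) → Σ (Packing s b) λ r → Thrifty r × ShiftedFrom p r
  thriftyShift vp q sh (acc rs) with thrifty-or-wasteful q
  ... | inj₁ thrifty = q , thrifty , sh
  ... | inj₂ (_ , w) = thriftyShift vp (fillWasteful q w) (fillWasteful-shifted vp sh w)
                         (rs (fillWasteful-decreases q w))

-- The positivity hypotheses are unused: termination rests on the bin-index potential, not on sizes.
lemma2 : (m n : ℕ) (s : Fin m → ℕ) (b : Fin n → ℕ) →
         (∀ i → 0 < s i) → (∀ j → 0 < b j) →
         (p : Packing s b) → Valid p →
         Σ (Packing s b) (λ q → Thrifty q × (∀ j → Used q j → Used p j))
lemma2 m n s b _ _ p vp with thriftyShift vp p (shiftedFrom-refl p) (<-wellFounded _)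
... | q , thrifty , shifted = q , thrifty , ShiftedFrom.usedOnly shifted
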